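{- Let $A$ be a type, $B$ an ordered type and $f:A\to B\to B$. (i) If $B$ is a pointed dCPO and $f\,a$ is continuous for every $a$, then for all $a:A$, $l:\mathsf{colist}\,A$: $\mathsf{cofold}\,f\,(\mathsf{cocons}\,a\,l)\simeq f\,a\,(\mathsf{cofold}\,f\,l)$. (ii) If $B$ is an ldCPO with a top element and $f\,a$ is l-continuous for every $a$, then for all $a,l$: $\widehat{\mathsf{cofold}}\,f\,(\mathsf{cocons}\,a\,l)\simeq f\,a\,(\widehat{\mathsf{cofold}}\,f\,l)$.
   Context: An ordered type has a reflexive transitive relation $\sqsubseteq$; $x\simeq y$ means $x\sqsubseteq y\land y\sqsubseteq x$; pointed means having a least element $\bot$. $U:\mathbb{N}\to B$ is directed if $\forall i\,j\,\exists k,\ U\,i\sqsubseteq U\,k\land U\,j\sqsubseteq U\,k$, downward-directed dually. $B$ is a dCPO if every directed $U$ has a supremum, an ldCPO if every downward-directed $U$ has an infimum. $g$ is continuous if $g(\sup U)=\sup(g\circ U)$ for every directed $U$, and l-continuous if $g(\inf U)=\inf(g\circ U)$ for every downward-directed $U$. $\mathsf{colist}\,A$ is the coinductive type with $\bot$ and $\mathsf{cocons}\,a\,l$, ordered by $\bot\sqsubseteq l$ and $\mathsf{cocons}\,a\,l_1\sqsubseteq\mathsf{cocons}\,a\,l_2$ if $l_1\sqsubseteq l_2$. $\mathsf{idl}\,s\,0=\mathsf{nil}$, $\mathsf{idl}\,\bot\,(i+1)=\mathsf{nil}$, $\mathsf{idl}(\mathsf{cocons}\,a\,s)(i+1)=\mathsf{cons}\,a\,(\mathsf{idl}\,s\,i)$.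 $\mathsf{fold}\,z\,f$: $\mathsf{nil}\mapsto z$, $\mathsf{cons}\,a\,l\mapsto f\,a\,(\mathsf{fold}\,z\,f\,l)$. $\mathsf{cofold}\,f\,s:=\sup_i\mathsf{fold}\,\bot\,f\,(\mathsf{idl}\,s\,i)$ and $\widehat{\mathsf{cofold}}\,f\,s:=\inf_i\mathsf{fold}\,\top\,f\,(\mathsf{idl}\,s\,i)$ (suprema/infima chosen by choice). -}

module Defs where

open import Level using (Level; _⊔_; suc)
open import Data.Nat using (ℕ; zero) renaming (suc to 1+)
open import Data.Product using (_×_; ∃)
open import Data.List using (List; []; _∷_)
open import Data.Maybe using (Maybe; just; nothing)
open import Relation.Binary.PropositionalEquality using (_≡_; refl)

record Ordered (b ℓ : Level) : Set (Level.suc (b ⊔ ℓ)) where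
  infix 4 _⊑_ _≃_
  field
    Carrier : Set b
    _⊑_     : Carrier → Carrier → Set ℓ
    ⊑-refl  : ∀ {x} → x ⊑ x
    ⊑-trans : ∀ {x y z} → x ⊑ y → y ⊑ z → x ⊑ z

  _≃_ : Carrier → Carrier → Set ℓ
  x ≃ y = (x ⊑ y) × (y ⊑ x)

  Directed : (ℕ → Carrier) → Set ℓ
  Directed U = ∀ i j → ∃ λ k → (U i ⊑ U k) × (U j ⊑ U k)

  DownDirected : (ℕ → Carrier) → Set ℓ
  DownDirected U = ∀ i j → ∃ λ k → (U k ⊑ U i) × (U k ⊑ U j)

  IsSup : (ℕ → Carrier) → Carrier → Set (b ⊔ ℓ)
  IsSup U s = (∀ i → U i ⊑ s) × (∀ t → (∀ i → U i ⊑ t) → s ⊑ t)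

  IsInf : (ℕ → Carrier) → Carrier → Set (b ⊔ ℓ)
  IsInf U s = (∀ i → s ⊑ U i) × (∀ t → (∀ i → t ⊑ U i) → t ⊑ s)

  IsLeast : Carrier → Set (b ⊔ ℓ)
  IsLeast x = ∀ y → x ⊑ y

  IsGreatest : Carrier → Set (b ⊔ ℓ)
  IsGreatest x = ∀ y → y ⊑ x

  Continuous : (Carrier → Carrier) → Set (b ⊔ ℓ)
  Continuous g = ∀ U s → Directed U → IsSup U s → IsSup (λ i → g (U i)) (g s)

  LContinuous : (Carrier → Carrier) → Set (b ⊔ ℓ)
  LContinuous g = ∀ U s → DownDirected U → IsInf U s → IsInf (λ i → g (U i)) (g s)

-- Pointed dCPO. The supremum is a chosen function ("by choice") on all
-- sequences, which is a supremum whenever the sequence is directed.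
record PointedDCPO {b ℓ : Level} (B : Ordered b ℓ) : Set (b ⊔ ℓ) where
  open Ordered B
  field
    ⊥ᴮ      : Carrier
    ⊥-least : IsLeast ⊥ᴮ
    sup     : (ℕ → Carrier) → Carrier
    sup-isSup : ∀ U → Directed U → IsSup U (sup U)

record TopLDCPO {b ℓ : Level} (B : Ordered b ℓ) : Set (b ⊔ ℓ) where
  open Ordered B
  field
    ⊤ᴮ         : Carrier
    ⊤-greatest : IsGreatest ⊤ᴮ
    inf        : (ℕ → Carrier) → Carrier
    inf-isInf  : ∀ U → DownDirected U → IsInf U (inf U)

-- Colists with constructors ⊥ and cocons (the coinductive type colist A).  This type is isomorphic to colist A.
record Colist {a : Level} (A : Set a) : Set a where
  field
    at     : ℕ → Maybe A
    closed : ∀ n → at n ≡ nothing → at (1+ n) ≡ nothing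

open Colist public

⊥c : ∀ {a} {A : Set a} → Colist A
⊥c .at _ = nothing
⊥c .closed _ _ = refl

cocons : ∀ {a} {A : Set a} → A → Colist A → Colist A
cocons x l .at zero = just x
cocons x l .at (1+ n) = l .at n
cocons x l .closed zero ()
cocons x l .closed (1+ n) e = l .closed n e

data ColistStep {a : Level} (A : Set a) : Set a where
  ⊥s      : ColistStep A
  coconsS : A → Colist A → ColistStep A

tailc : ∀ {a} {A : Set a} → Colist A → Colist A
tailc s .at n = s .at (1+ n)
tailc s .closed n e = s .closed (1+ n) e

out : ∀ {a} {A : Set a} → Colist A → ColistStep A
out s with s .at zero
... | nothing = ⊥s
... | just x  = coconsS x (tailc s)

idl : ∀ {a} {A : Set a} → Colist A → ℕ → List A
idl s zero = []
idl s (1+ i) with out s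
... | ⊥s          = []
... | coconsS x l = x ∷ idl l i

fold : ∀ {a c} {A : Set a} {C : Set c} → C → (A → C → C) → List A → C
fold z f []       = z
fold z f (x ∷ l)  = f x (fold z f l)

cofold : ∀ {a b ℓ} {A : Set a} {B : Ordered b ℓ} → PointedDCPO B →
         (A → Ordered.Carrier B → Ordered.Carrier B) → Colist A → Ordered.Carrier B
cofold D f s = PointedDCPO.sup D (λ i → fold (PointedDCPO.⊥ᴮ D) f (idl s i))

cofoldᵗ : ∀ {a b ℓ} {A : Set a} {B : Ordered b ℓ} → TopLDCPO B →
          (A → Ordered.Carrier B → Ordered.Carrier B) → Colist A → Ordered.Carrier B
cofoldᵗ D f s = TopLDCPO.inf D (λ i → fold (TopLDCPO.⊤ᴮ D) f (idl s i))

-- The approximants fold ⊥ f (idl (cocons x l) i) are ⊥ at i = 0 and f x applied to the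
-- approximants of l afterwards. Continuity of f x turns the supremum of the latter into
-- f x (cofold f l), and a leading ⊥ does not change a supremum. Part (ii) is part (i)
-- in the order dual, where infima become suprema and l-continuity becomes continuity.
module Submission where

open import Defs
open import Function using (_∘_)
open import Data.Product using (_×_; _,_; proj₁; swap)
open import Data.Nat using (ℕ; zero; suc; _≤_; s≤s; _⊔_)
open import Data.Nat.Properties using (m≤m⊔n; m≤n⊔m)
open import Relation.Binary.Core using (_Preserves_⟶_)

_ᵒᵖ : ∀ {b ℓ} → Ordered b ℓ → Ordered b ℓ
B ᵒᵖ = record
  { Carrier = Carrier
  ; _⊑_     = λ x y → y ⊑ x
  ; ⊑-refl  = ⊑-refl
  ; ⊑-trans = λ x⊒y y⊒z → ⊑-trans y⊒z x⊒y
  }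
  where open Ordered B

topLDCPO⇒pointedDCPOᵒᵖ : ∀ {b ℓ} {B : Ordered b ℓ} → TopLDCPO B → PointedDCPO (B ᵒᵖ)
topLDCPO⇒pointedDCPOᵒᵖ D = record
  { ⊥ᴮ        = ⊤ᴮ
  ; ⊥-least   = ⊤-greatest
  ; sup       = inf
  ; sup-isSup = inf-isInf
  }
  where open TopLDCPO D

module _ {b ℓ} (B : Ordered b ℓ) where
  open Ordered B

  continuous⇒monotone : ∀ {g} → Continuous g → g Preserves _⊑_ ⟶ _⊑_
  continuous⇒monotone {g} g-cont {x} {y} x⊑y = proj₁ (g-cont U y U-directed U-isSup) 0
    where
    U : ℕ → Carrier
    U zero    = x
    U (suc _) = y

    U⊑y : ∀ i → U i ⊑ y
    U⊑y zero    = x⊑y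
    U⊑y (suc _) = ⊑-refl

    U-directed : Directed U
    U-directed i j = 1 , U⊑y i , U⊑y j

    U-isSup : IsSup U y
    U-isSup = U⊑y , λ t U⊑t → U⊑t 1

  ascending⇒directed : ∀ {U} → (∀ {i j} → i ≤ j → U i ⊑ U j) → Directed U
  ascending⇒directed U-asc i j = i ⊔ j , U-asc (m≤m⊔n i j) , U-asc (m≤n⊔m i j)

  isSup-unique : ∀ {U s t} → IsSup U s → IsSup U t → s ≃ t
  isSup-unique (U⊑s , s-least) (U⊑t , t-least) = s-least _ U⊑t , t-least _ U⊑s

  isSup-least∷ : ∀ {U s} → IsLeast (U 0) → IsSup (U ∘ suc) s → IsSup U s
  isSup-least∷ {U} {s} U₀-least (U∘suc⊑s , s-least) = U⊑s , λ t U⊑t → s-least t (U⊑t ∘ suc)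
    where
    U⊑s : ∀ i → U i ⊑ s
    U⊑s zero    = U₀-least s
    U⊑s (suc i) = U∘suc⊑s i

module _ {a b ℓ} {A : Set a} {B : Ordered b ℓ} (D : PointedDCPO B) where
  open Ordered B
  open PointedDCPO D

  approximant : (A → Carrier → Carrier) → Colist A → ℕ → Carrier
  approximant f l i = fold ⊥ᴮ f (idl l i)

  approximant-ascending : ∀ {f} → (∀ x → f x Preserves _⊑_ ⟶ _⊑_) →
                          ∀ l {i j} → i ≤ j → approximant f l i ⊑ approximant f l j
  approximant-ascending f-mono l {zero}  _       = ⊥-least _
  approximant-ascending f-mono l {suc i} (s≤s i≤j) with out l
  ... | ⊥s          = ⊑-refl
  ... | coconsS x k = f-mono x (approximant-ascending f-mono k i≤j)

  cofold-cocons : ∀ {f} → (∀ x → Continuous (f x)) →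
                  ∀ x l → cofold D f (cocons x l) ≃ f x (cofold D f l)
  cofold-cocons {f} f-cont x l =
    isSup-unique B (sup-isSup _ (directed (cocons x l)))
                   (isSup-least∷ B ⊥-least f-cofold-isSup)
    where
    directed : ∀ k → Directed (approximant f k)
    directed k = ascending⇒directed B
      (approximant-ascending (λ y → continuous⇒monotone B (f-cont y)) k)

    f-cofold-isSup : IsSup (λ i → f x (approximant f l i)) (f x (cofold D f l))
    f-cofold-isSup = f-cont x _ _ (directed l) (sup-isSup _ (directed l))

mainTheorem11 : ∀ {a b ℓ} {A : Set a} (B : Ordered b ℓ) (f : A → Ordered.Carrier B → Ordered.Carrier B)
    → ((D : PointedDCPO B) → (∀ x → Ordered.Continuous B (f x))
    → ∀ x l → Ordered._≃_ B (cofold D f (cocons x l)) (f x (cofold D f l)))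
    × ((D : TopLDCPO B) → (∀ x → Ordered.LContinuous B (f x))
    → ∀ x l → Ordered._≃_ B (cofoldᵗ D f (cocons x l)) (f x (cofoldᵗ D f l)))
mainTheorem11 B f =
    (λ D f-cont → cofold-cocons D f-cont)
  , (λ D f-lcont x l → swap (cofold-cocons (topLDCPO⇒pointedDCPOᵒᵖ D) f-lcont x l))
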